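{- For every $k\in\omega+1$ and every valuation tree $T\subseteq T_2$ of height $k$, there exists a unique structural isomorphism $f\colon T_2({<}k)\to T$.
   Context: Conventions: $n=\{0,\dots,n-1\}$. A tree is a partially ordered set $(T,<_T)$ in which each set $\{s: s<_T t\}$ is finite and linearly ordered; nonempty trees considered have a unique minimal element (root). The level $|t|_T$ of $t$ is $|\{s: s<_T t\}|$; $T(n)$ is the set of nodes of level $n$, $T({<}n)$ the set of nodes of level $<n$; the height $h(T)$ is the least $h$ with $T(h)=\emptyset$ (or $\omega$ if none). $\mathrm{Succ}_T(t)=\{s: t\le_T s\}$, $\mathrm{ImmSucc}_T(t)$ is the set of immediate successors of $t$. The meet $s\wedge_T t$ is the largest common predecessor. $T$ is balanced if either it has infinite height and no maximal nodes, or all maximal nodes lie in $T(h(T)-1)$. A subtree of $T$ is a subset $T'$ with the induced order such that $s\wedge_{T'}t=s\wedge_T t$ for all $s,t\in T'$. A strong subtree $S$ of $T$ is either empty or a subtree that is rooted and balanced, each level $S(n)$ is contained in some level $T(m)$, and for every non-maximal $s\in S$ and every $t\in\mathrm{ImmSucc}_T(s)$ the set $\mathrm{ImmSucc}_S(s)\cap\mathrm{Succ}_T(t)$ is a singleton. The level set of $D\subseteq T$ is $L_T(D)=\{|t|_T: t\in D\}$. $T_1$ is the tree of all finite $\{0,1\}$-vectors $\vec v\colon n\to 2$ (length $|\vec v|=n$, coordinates $v_i$) ordered by end-extension, rooted at the empty vector. $T_2$ is the tree of all finite strictly lower triangular square $\{0,1\}$-matrices $A\colon n\times n\to 2$ (i.e.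 $A_{i,j}=0$ when $i\le j$; $|A|=n$ is the number of rows; indices start at $0$), ordered by $A\le_{T_2}B$ iff $|A|\le|B|$ and $A_{i,j}=B_{i,j}$ for all $i,j<|A|$, rooted at the empty matrix. Thus the level of $\vec v$ in $T_1$ is $|\vec v|$ and the level of $A$ in $T_2$ is $|A|$. A vector strong subtree of $(T_1,T_2)$ of height $k\in\omega+1$ is a pair $(S_1,S_2)$ where $S_i$ is a strong subtree of $T_i$ of height $k$ and $L_{T_1}(S_1)=L_{T_2}(S_2)$. For a matrix $A$ with $|A|=n$ and vector $\vec v$ with $|\vec v|=n$, $A^\frown\vec v$ is the $(n+1)\times(n+1)$ matrix with $(A^\frown\vec v)_{i,j}=A_{i,j}$ for $i,j<n$, $(A^\frown\vec v)_{n,i}=v_i$ for $i<n$, and $(A^\frown\vec v)_{j,n}=0$ for $j\le n$. For a vector strong subtree $(S_1,S_2)$, the valuation tree $\mathrm{val}(S_1,S_2)\subseteq S_2$ is defined recursively: the root of $S_2$ belongs to it; if $A\in\mathrm{val}(S_1,S_2)$, $\vec v\in S_1(|A|_{S_2})$ and $\{C\}=\mathrm{ImmSucc}_{S_2}(A)\cap\mathrm{Succ}_{T_2}(A^\frown\vec v)$, then $C\in\mathrm{val}(S_1,S_2)$; there are no other nodes. A valuation tree is a tree $T\subseteq T_2$ with $T=\mathrm{val}(S_1,S_2)$ for some vector strong subtree $(S_1,S_2)$ of $(T_1,T_2)$ of some height in $\omega+1$. For subtrees $T,T'$ of $T_2$, a structural isomorphism $f\colon T\to T'$ is a tree isomorphism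 (preserving relative levels of nodes) such that for all $A,B,C\in T$ with $|A|\le|B|<|C|$ we have $f(C)_{|f(B)|,|f(A)|}=C_{|B|,|A|}$. -}

module Defs where

open import Data.Nat using (ℕ; zero; suc; _<_; _≤_; _∸_)
open import Data.Bool using (Bool; false)
open import Data.List using (List; []; _∷_; _++_; length)
open import Data.List.Membership.Propositional using (_∈_)
open import Data.List.Relation.Unary.Unique.Propositional using (Unique)
open import Data.Product using (Σ; ∃; _×_)
open import Data.Sum using (_⊎_)
open import Data.Unit using (⊤)
open import Relation.Nullary using (¬_)
open import Relation.Binary.PropositionalEquality using (_≡_)

data ℕ∞ : Set where
  fin : ℕ → ℕ∞
  ω   : ℕ∞

_<∞_ : ℕ → ℕ∞ → Set
n <∞ fin k = n < k
n <∞ ω     = ⊤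

-- A "tree" / subset is a predicate on sequences; the ambient trees T₁, T₂
-- below are predicates closed under prefixes, so the level of a node in
-- them is its length.

module Tree {X : Set} where

  Node : Set
  Node = List X

  _⊑_ : Node → Node → Set
  s ⊑ t = Σ Node λ u → s ++ u ≡ t

  _⊏_ : Node → Node → Set
  s ⊏ t = s ⊑ t × length s < length t

  IsMeet : (Node → Set) → Node → Node → Node → Set
  IsMeet P s t m = P m × m ⊑ s × m ⊑ t ×
                   (∀ m' → P m' → m' ⊑ s → m' ⊑ t → m' ⊑ m)

  IsSubtree : (Node → Set) → (Node → Set) → Set
  IsSubtree T S = (∀ s → S s → T s) ×
                  (∀ s t m → S s → S t → IsMeet T s t m → IsMeet S s t m)

  LevelIn : (Node → Set) → Node → ℕ → Set
  LevelIn S t n = Σ (List Node) λ l → Unique l ×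
                  (∀ s → (s ∈ l → S s × s ⊏ t) × (S s × s ⊏ t → s ∈ l)) ×
                  length l ≡ n

  AtLevel : (Node → Set) → ℕ → Node → Set
  AtLevel S n t = S t × LevelIn S t n

  Height : (Node → Set) → ℕ∞ → Set
  Height S (fin h) = (∀ t → ¬ AtLevel S h t) × (∀ m → m < h → ∃ (AtLevel S m))
  Height S ω       = ∀ m → ∃ (AtLevel S m)

  Maximal : (Node → Set) → Node → Set
  Maximal S t = S t × (∀ s → S s → ¬ (t ⊏ s))

  IsRoot : (Node → Set) → Node → Set
  IsRoot S r = S r × (∀ s → S s → r ⊑ s)

  Rooted : (Node → Set) → Set
  Rooted S = Σ Node (IsRoot S)

  Balanced : (Node → Set) → Set
  Balanced S = (Height S ω × (∀ t → ¬ Maximal S t)) ⊎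
               (Σ ℕ λ h → Height S (fin h) × (∀ t → Maximal S t → LevelIn S t (h ∸ 1)))

  ImmSucc : (Node → Set) → Node → Node → Set
  ImmSucc S s u = S u × s ⊏ u × (∀ w → S w → s ⊏ w → ¬ (w ⊏ u))

  -- S is a strong subtree of T (T a prefix-closed tree, so T-levels are lengths)
  IsStrongSubtree : (Node → Set) → (Node → Set) → Set
  IsStrongSubtree T S =
    (∀ s → ¬ S s) ⊎
    (IsSubtree T S × Rooted S × Balanced S ×
     (∀ n → Σ ℕ λ m → ∀ t → AtLevel S n t → length t ≡ m) ×
     (∀ s t → S s → ¬ Maximal S s → ImmSucc T s t →
        Σ Node λ u → (ImmSucc S s u × t ⊑ u) ×
                     (∀ u' → ImmSucc S s u' → t ⊑ u' → u' ≡ u)))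

  InLevelSet : (Node → Set) → ℕ → Set
  InLevelSet D n = Σ Node λ t → D t × length t ≡ n

open Tree public

-- T₁ : finite 0/1 vectors;  T₂ : finite strictly lower triangular 0/1
-- matrices, represented by their list of rows, row i being the list of
-- entries A_{i,0},…,A_{i,i-1} (entries with i ≤ j are 0 implicitly).
-- The order "|A| ≤ |B| and A, B agree on |A|×|A|" is then end-extension.

Vect : Set
Vect = List Bool

Mat : Set
Mat = List (List Bool)

T₁ : Vect → Set
T₁ _ = ⊤

RowsOK : ℕ → Mat → Set
RowsOK i []       = ⊤
RowsOK i (r ∷ rs) = length r ≡ i × RowsOK (suc i) rs

T₂ : Mat → Set
T₂ = RowsOK 0

_⌢_ : Mat → Vect → Mat
A ⌢ v = A ++ (v ∷ [])

nth : {A : Set} → A → List A → ℕ → A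
nth d []       _       = d
nth d (x ∷ xs) zero    = x
nth d (x ∷ xs) (suc n) = nth d xs n

-- A_{i,j}  (0 = false outside the strictly lower triangle)
entry : Mat → ℕ → ℕ → Bool
entry A i j = nth false (nth [] A i) j

IsVectorStrongSubtree : (Vect → Set) → (Mat → Set) → ℕ∞ → Set
IsVectorStrongSubtree S₁ S₂ k =
  IsStrongSubtree T₁ S₁ × IsStrongSubtree T₂ S₂ ×
  Height S₁ k × Height S₂ k ×
  (∀ n → (InLevelSet S₁ n → InLevelSet S₂ n) × (InLevelSet S₂ n → InLevelSet S₁ n))

data Val (S₁ : Vect → Set) (S₂ : Mat → Set) : Mat → Set where
  root : ∀ {A} → IsRoot S₂ A → Val S₁ S₂ A
  step : ∀ {A v C n} → Val S₁ S₂ A → LevelIn S₂ A n → AtLevel S₁ n v →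
         ImmSucc S₂ A C → (A ⌢ v) ⊑ C → Val S₁ S₂ C

IsValuationTree : (Mat → Set) → Set₁
IsValuationTree T =
  Σ ℕ∞ λ k → Σ (Vect → Set) λ S₁ → Σ (Mat → Set) λ S₂ →
    IsVectorStrongSubtree S₁ S₂ k × (∀ A → (T A → Val S₁ S₂ A) × (Val S₁ S₂ A → T A))

Below : ℕ∞ → Mat → Set
Below k A = T₂ A × length A <∞ k

IsStructIso : ℕ∞ → (Mat → Set) → (Mat → Mat) → Set
IsStructIso k T f =
  (∀ A → Below k A → T (f A)) ×
  (∀ A B → Below k A → Below k B → f A ≡ f B → A ≡ B) ×
  (∀ C → T C → Σ Mat λ A → Below k A × f A ≡ C) ×
  (∀ A B → Below k A → Below k B → (A ⊑ B → f A ⊑ f B) × (f A ⊑ f B → A ⊑ B)) ×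
  (∀ A B → Below k A → Below k B →
     (length A ≤ length B → length (f A) ≤ length (f B)) ×
     (length (f A) ≤ length (f B) → length A ≤ length B)) ×
  (∀ A B C → Below k A → Below k B → Below k C →
     length A ≤ length B → length B < length C →
     entry (f C) (length (f B)) (length (f A)) ≡ entry C (length B) (length A))

module Submission where

-- Let ℓ₀ < ℓ₁ < … be the lengths of the nodes of S₁ and S₂ at levels 0, 1, …; they agree because
-- S₁ and S₂ are strong subtrees with the same level set. A node of S₁ at level n is determined by
-- its entries at the splitting positions ℓ₀, …, ℓₙ₋₁, and a node of val(S₁,S₂) at level n+1 by its
-- parent and the S₁-vector appended to it. Hence a row ρ of A ∈ T₂(<k) can be read as the entries
-- of such a vector, and walking down from the root row by row gives embed : T₂(<k) → T with
-- embed(A) at level |A| and embed(A)[ℓ_b, ℓ_a] = A[b, a]: a structural isomorphism. Conversely a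
-- structural isomorphism f sends A ⌢ ρ to a child of f(A) whose new row has the entries of ρ at
-- the splitting positions, which pins it down, so f = embed by induction on |A|.

open import Defs
open import Data.Bool using (Bool; false)
import Data.Bool.Properties as Bool
open import Data.Empty using (⊥; ⊥-elim)
open import Data.List using (List; []; _∷_; _++_; _∷ʳ_; length; take; drop; initLast; _∷ʳ′_)
open import Data.List.Membership.Propositional using (_∈_)
open import Data.List.Membership.Propositional.Properties.WithK using (unique∧set⇒bag)
open import Data.List.Properties
  using (length-++-sucʳ; length-++-≤ˡ; ++-identityʳ; ++-assoc; ∷-injective;
         length-take; take++drop≡id; ≡-dec)
open import Data.List.Relation.Binary.BagAndSetEquality using (∼bag⇒↭)
open import Data.List.Relation.Binary.Permutation.Propositional.Properties using (↭-length)
open import Data.List.Relation.Unary.Any using (here; there)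
open import Data.List.Relation.Unary.All using () renaming (tabulate to All-tabulate)
open import Data.List.Relation.Unary.AllPairs using ([]; _∷_)
open import Data.List.Relation.Unary.Unique.Propositional using (Unique)
open import Data.Nat using (ℕ; zero; suc; _+_; _<_; _≤_; z≤n; s≤s; _≤?_)
open import Data.Nat.Induction using (<-rec)
open import Data.Nat.Properties
  using (≤-refl; ≤-trans; ≤-reflexive; ≤-antisym; ≤-pred; <-irrefl; <-trans; ≤-<-trans; <-≤-trans;
         <⇒≤; <⇒≱; <⇒≢; ≰⇒>; n≤1+n; m≤n+m; m≤m+n; m≤n⇒m<n∨m≡n; m≤n⇒m⊓n≡m; m≤n+m∸n; +-suc; +-identityʳ; +-monoˡ-≤;
         suc-injective)
open import Data.Product using (Σ; _×_; _,_; proj₁; proj₂)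
open import Data.Sum using (_⊎_; inj₁; inj₂)
open import Data.Unit using (tt)
open import Function.Bundles using (mk⇔)
open import Relation.Binary.Definitions using (DecidableEquality)
open import Relation.Binary.PropositionalEquality
  using (_≡_; refl; sym; trans; cong; cong₂; subst; subst₂; module ≡-Reasoning)
open import Relation.Nullary using (¬_; Dec; yes; no; contradiction)

module _ {X : Set} where

  length-∷ʳ : (s : List X) (x : X) → length (s ∷ʳ x) ≡ suc (length s)
  length-∷ʳ s x = trans (length-++-sucʳ s x []) (cong (λ u → suc (length u)) (++-identityʳ s))

  length-<-++-∷ : (s : List X) (y : X) (u : List X) → length s < length (s ++ y ∷ u)
  length-<-++-∷ s y u = subst (length s <_) (sym (length-++-sucʳ s y u)) (s≤s (length-++-≤ˡ s))

  ⊑-refl : {s : List X} → s ⊑ s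
  ⊑-refl {s} = [] , ++-identityʳ s

  ⊑-trans : {s t w : List X} → s ⊑ t → t ⊑ w → s ⊑ w
  ⊑-trans {s} (u , refl) (u' , refl) = u ++ u' , sym (++-assoc s u u')

  ⊑⇒length≤ : {s t : List X} → s ⊑ t → length s ≤ length t
  ⊑⇒length≤ {s} (_ , refl) = length-++-≤ˡ s

  ⊑∧length≥⇒≡ : {s t : List X} → s ⊑ t → length t ≤ length s → s ≡ t
  ⊑∧length≥⇒≡ {s} ([] , e)        _  = trans (sym (++-identityʳ s)) e
  ⊑∧length≥⇒≡ {s} (y ∷ u , refl) le = contradiction le (<⇒≱ (length-<-++-∷ s y u))

  ⊏⇒⊑ : {s t : List X} → s ⊏ t → s ⊑ t
  ⊏⇒⊑ = proj₁

  ⊏-irrefl : {s : List X} → ¬ (s ⊏ s)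
  ⊏-irrefl (_ , lt) = <-irrefl refl lt

  ⊏-trans : {s t w : List X} → s ⊏ t → t ⊏ w → s ⊏ w
  ⊏-trans (p , l) (q , l') = ⊑-trans p q , <-trans l l'

  ⊏-⊑-trans : {s t w : List X} → s ⊏ t → t ⊑ w → s ⊏ w
  ⊏-⊑-trans (p , l) q = ⊑-trans p q , <-≤-trans l (⊑⇒length≤ q)

  ⊏-∷ʳ : {s : List X} {x : X} → s ⊏ (s ∷ʳ x)
  ⊏-∷ʳ {s} {x} = (x ∷ [] , refl) , length-<-++-∷ s x []

  ⊑⇒≡⊎⊏ : {s t : List X} → s ⊑ t → s ≡ t ⊎ s ⊏ t
  ⊑⇒≡⊎⊏ {s} {t} p with length t ≤? length s
  ... | yes le = inj₁ (⊑∧length≥⇒≡ p le)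
  ... | no nle = inj₂ (p , ≰⇒> nle)

  private
    ++-≡⇒⊑ : (s s' u u' : List X) → s ++ u ≡ s' ++ u' → length s ≤ length s' → s ⊑ s'
    ++-≡⇒⊑ []      s'       u u' e le       = s' , refl
    ++-≡⇒⊑ (x ∷ s) (y ∷ s') u u' e (s≤s le) with refl , e' ← ∷-injective e =
      let (w , ew) = ++-≡⇒⊑ s s' u u' e' le in w , cong (x ∷_) ew

  ⊑-by-length : {s s' t : List X} → s ⊑ t → s' ⊑ t → length s ≤ length s' → s ⊑ s'
  ⊑-by-length {s} {s'} (u , e) (u' , e') = ++-≡⇒⊑ s s' u u' (trans e (sym e'))

  ⊑-≡-length : {s s' t : List X} → s ⊑ t → s' ⊑ t → length s ≡ length s' → s ≡ s'
  ⊑-≡-length p q e = ⊑∧length≥⇒≡ (⊑-by-length p q (≤-reflexive e)) (≤-reflexive (sym e))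

  ⊑-linear : {s s' t : List X} → s ⊑ t → s' ⊑ t → s ⊑ s' ⊎ s' ⊏ s
  ⊑-linear {s} {s'} p q with length s ≤? length s'
  ... | yes le = inj₁ (⊑-by-length p q le)
  ... | no nle = inj₂ (⊑-by-length q p (<⇒≤ (≰⇒> nle)) , ≰⇒> nle)

  ∷ʳ-ImmSucc : (P : List X → Set) {u : List X} {x : X} → P (u ∷ʳ x) → ImmSucc P u (u ∷ʳ x)
  ∷ʳ-ImmSucc P {u} {x} Pux = Pux , ⊏-∷ʳ , λ w _ (_ , u<w) (_ , w<ux) →
    <-irrefl refl (<-≤-trans u<w (≤-pred (<-≤-trans w<ux (≤-reflexive (length-∷ʳ u x)))))

  ImmSucc-unique-pred : (P : List X → Set) {p p' t : List X} → P p → P p' →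
                        ImmSucc P p t → ImmSucc P p' t → p ≡ p'
  ImmSucc-unique-pred P Pp Pp' (_ , p⊏t , p-imm) (_ , p'⊏t , p'-imm) with ⊑-linear (⊏⇒⊑ p⊏t) (⊏⇒⊑ p'⊏t)
  ... | inj₂ p'⊏p = ⊥-elim (p'-imm _ Pp p'⊏p p⊏t)
  ... | inj₁ p⊑p' with ⊑⇒≡⊎⊏ p⊑p'
  ...   | inj₁ p≡p' = p≡p'
  ...   | inj₂ p⊏p' = ⊥-elim (p-imm _ Pp' p⊏p' p'⊏t)

  nth-++-length : (d : X) (s w : List X) → nth d (s ++ w) (length s) ≡ nth d w 0
  nth-++-length d []      w = refl
  nth-++-length d (x ∷ s) w = nth-++-length d s w

  nth-∷ʳ : (d : X) (s : List X) (x : X) → nth d (s ∷ʳ x) (length s) ≡ x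
  nth-∷ʳ d s x = nth-++-length d s (x ∷ [])

  nth-⊑ : (d : X) {s t : List X} → s ⊑ t → ∀ i → i < length s → nth d s i ≡ nth d t i
  nth-⊑ d {x ∷ s} (u , refl) zero    _        = refl
  nth-⊑ d {x ∷ s} (u , refl) (suc i) (s≤s lt) = nth-⊑ d {s} (u , refl) i lt

  nth-≥length : (d : X) (s : List X) → ∀ i → length s ≤ i → nth d s i ≡ d
  nth-≥length d []      i       _        = refl
  nth-≥length d (x ∷ s) (suc i) (s≤s le) = nth-≥length d s i le

  ∷ʳ-⊑⇒nth : (d : X) {s t : List X} {x : X} → (s ∷ʳ x) ⊑ t → nth d t (length s) ≡ x
  ∷ʳ-⊑⇒nth d {s} {t} {x} p =
    trans (sym (nth-⊑ d p (length s) (≤-reflexive (sym (length-∷ʳ s x))))) (nth-∷ʳ d s x)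

  ⊏⇒∷ʳ-nth-⊑ : (d : X) {s t : List X} → s ⊏ t → (s ∷ʳ nth d t (length s)) ⊑ t
  ⊏⇒∷ʳ-nth-⊑ d {s} (([] , refl) , lt) = contradiction lt (<-irrefl (cong length (sym (++-identityʳ s))))
  ⊏⇒∷ʳ-nth-⊑ d {s} ((y ∷ u , refl) , _) =
    subst (λ z → (s ∷ʳ z) ⊑ (s ++ y ∷ u)) (sym (nth-++-length d s (y ∷ u))) (u , ++-assoc s (y ∷ []) u)

  nth-ext : (d : X) (r r' : List X) → length r ≡ length r' →
            (∀ j → j < length r → nth d r j ≡ nth d r' j) → r ≡ r'
  nth-ext d []      []       _ _ = refl
  nth-ext d (x ∷ r) (y ∷ r') e h with refl ← h zero (s≤s z≤n) =
    cong (x ∷_) (nth-ext d r r' (suc-injective e) (λ j lt → h (suc j) (s≤s lt)))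

  take-⊑ : ∀ j (B : List X) → take j B ⊑ B
  take-⊑ j B = drop j B , take++drop≡id j B

  length-take-≤ : ∀ j (B : List X) → j ≤ length B → length (take j B) ≡ j
  length-take-≤ j B le = trans (length-take j B) (m≤n⇒m⊓n≡m le)

  take-suc : (d : X) → ∀ j (B : List X) → j < length B → take (suc j) B ≡ take j B ∷ʳ nth d B j
  take-suc d zero    (x ∷ B) _        = refl
  take-suc d (suc j) (x ∷ B) (s≤s lt) = cong (x ∷_) (take-suc d j B lt)

module LongestCommonPrefix {X : Set} (_≟_ : DecidableEquality X) where

  lcp : List X → List X → List X
  lcp (x ∷ a) (y ∷ b) with x ≟ y
  ... | yes _ = x ∷ lcp a b
  ... | no  _ = []
  lcp _ _ = []

  lcp-⊑ˡ : (a b : List X) → lcp a b ⊑ a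
  lcp-⊑ˡ []      b = [] , refl
  lcp-⊑ˡ (x ∷ a) [] = x ∷ a , refl
  lcp-⊑ˡ (x ∷ a) (y ∷ b) with x ≟ y
  ... | yes _ = let (w , e) = lcp-⊑ˡ a b in w , cong (x ∷_) e
  ... | no  _ = x ∷ a , refl

  lcp-⊑ʳ : (a b : List X) → lcp a b ⊑ b
  lcp-⊑ʳ []      b = b , refl
  lcp-⊑ʳ (x ∷ a) [] = [] , refl
  lcp-⊑ʳ (x ∷ a) (y ∷ b) with x ≟ y
  ... | yes refl = let (w , e) = lcp-⊑ʳ a b in w , cong (x ∷_) e
  ... | no  _    = y ∷ b , refl

  lcp-greatest : (c a b : List X) → c ⊑ a → c ⊑ b → c ⊑ lcp a b
  lcp-greatest []      a       b       _       _         = lcp a b , refl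
  lcp-greatest (z ∷ c) (x ∷ a) (y ∷ b) (u , e) (u' , e') with x ≟ y | ∷-injective e | ∷-injective e'
  ... | yes _ | refl , e₁ | refl , e₂ = let (w , ew) = lcp-greatest c a b (u , e₁) (u' , e₂) in w , cong (z ∷_) ew
  ... | no ne | refl , _  | refl , _  = ⊥-elim (ne refl)

  lcp-IsMeet : (P : List X → Set) (a b : List X) → P (lcp a b) → IsMeet P a b (lcp a b)
  lcp-IsMeet P a b Pm = Pm , lcp-⊑ˡ a b , lcp-⊑ʳ a b , λ c _ → lcp-greatest c a b

unique-length-≡ : {A : Set} (xs ys : List A) → Unique xs → Unique ys →
                  (∀ z → (z ∈ xs → z ∈ ys) × (z ∈ ys → z ∈ xs)) → length xs ≡ length ys
unique-length-≡ xs ys uxs uys same =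
  ↭-length (∼bag⇒↭ (unique∧set⇒bag uxs uys (mk⇔ (proj₁ (same _)) (proj₂ (same _)))))

≤-<∞-trans : ∀ {a b} (k : ℕ∞) → a ≤ b → b <∞ k → a <∞ k
≤-<∞-trans (fin h) le lt = ≤-<-trans le lt
≤-<∞-trans ω       _  _  = tt

_<∞?_ : ∀ a (k : ℕ∞) → Dec (a <∞ k)
a <∞? fin h = suc a ≤? h
a <∞? ω     = yes tt

RowsOK-⊑ : ∀ {i} {s t : Mat} → s ⊑ t → RowsOK i t → RowsOK i s
RowsOK-⊑ {s = []}    _          _             = tt
RowsOK-⊑ {s = x ∷ s} (u , refl) (e , rest) = e , RowsOK-⊑ {s = s} (u , refl) rest

RowsOK-∷ʳ⁺ : ∀ i (A : Mat) (v : Vect) → RowsOK i A → length v ≡ i + length A → RowsOK i (A ∷ʳ v)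
RowsOK-∷ʳ⁺ i []      v _          e = trans e (+-identityʳ i) , tt
RowsOK-∷ʳ⁺ i (x ∷ A) v (e , rest) e' = e , RowsOK-∷ʳ⁺ (suc i) A v rest (trans e' (+-suc i (length A)))

RowsOK-row-length : ∀ i (A : Mat) b → b < length A → RowsOK i A → length (nth [] A b) ≡ i + b
RowsOK-row-length i (x ∷ A) zero    _        (e , _)    = trans e (sym (+-identityʳ i))
RowsOK-row-length i (x ∷ A) (suc b) (s≤s lt) (_ , rest) =
  trans (RowsOK-row-length (suc i) A b lt rest) (sym (+-suc i b))

tabulateℕ : ℕ → (ℕ → Bool) → Vect
tabulateℕ zero    f = []
tabulateℕ (suc n) f = f 0 ∷ tabulateℕ n (λ i → f (suc i))

length-tabulateℕ : ∀ n f → length (tabulateℕ n f) ≡ n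
length-tabulateℕ zero    f = refl
length-tabulateℕ (suc n) f = cong suc (length-tabulateℕ n (λ i → f (suc i)))

nth-tabulateℕ : ∀ n f j → j < n → nth false (tabulateℕ n f) j ≡ f j
nth-tabulateℕ (suc n) f zero    _        = refl
nth-tabulateℕ (suc n) f (suc j) (s≤s lt) = nth-tabulateℕ n (λ i → f (suc i)) j lt

root-level : {X : Set} {S : List X → Set} {r : List X} → IsRoot S r → LevelIn S r 0
root-level (_ , r⊑) = [] , [] , (λ s → (λ ()) , λ (Ss , _ , lt) → contradiction (⊑⇒length≤ (r⊑ s Ss)) (<⇒≱ lt)) , refl

UniqueChildThrough : {X : Set} → (List X → Set) → List X → List X → Set
UniqueChildThrough {X} S s t =
  Σ (List X) λ u → (ImmSucc S s u × t ⊑ u) × (∀ u' → ImmSucc S s u' → t ⊑ u' → u' ≡ u)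

StrictlyIncreasingBelow : ℕ∞ → (ℕ → ℕ) → Set
StrictlyIncreasingBelow k f = ∀ {i j} → i < j → j <∞ k → f i < f j

RangeBelow-⊆ : ℕ∞ → (ℕ → ℕ) → (ℕ → ℕ) → Set
RangeBelow-⊆ k f g = ∀ n → n <∞ k → Σ ℕ λ j → j <∞ k × g j ≡ f n

private
  ≤-from-agreement-below : (k : ℕ∞) {f g : ℕ → ℕ} →
    StrictlyIncreasingBelow k f → StrictlyIncreasingBelow k g → RangeBelow-⊆ k f g →
    ∀ n → n <∞ k → (∀ i → i < n → f i ≡ g i) → g n ≤ f n
  ≤-from-agreement-below k {f} {g} f-inc g-inc f⊆g n n<k agree with f⊆g n n<k
  ... | j , j<k , gj≡fn with n ≤? j
  ...   | no  n≰j = contradiction (trans (agree j (≰⇒> n≰j)) gj≡fn) (<⇒≢ (f-inc (≰⇒> n≰j) n<k))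
  ...   | yes n≤j with m≤n⇒m<n∨m≡n n≤j
  ...     | inj₁ n<j  = <⇒≤ (subst (g n <_) gj≡fn (g-inc n<j j<k))
  ...     | inj₂ refl = ≤-reflexive gj≡fn

strictlyIncreasing-sameRange⇒≡ : (k : ℕ∞) {f g : ℕ → ℕ} →
  StrictlyIncreasingBelow k f → StrictlyIncreasingBelow k g → RangeBelow-⊆ k f g → RangeBelow-⊆ k g f →
  ∀ n → n <∞ k → f n ≡ g n
strictlyIncreasing-sameRange⇒≡ k {f} {g} f-inc g-inc f⊆g g⊆f = <-rec (λ n → n <∞ k → f n ≡ g n) agreeAt
  where
    agreeAt : ∀ n → (∀ {i} → i < n → i <∞ k → f i ≡ g i) → n <∞ k → f n ≡ g n
    agreeAt n rec n<k = ≤-antisym (≤-from-agreement-below k g-inc f-inc g⊆f n n<k (λ i i<n → sym (agree i i<n)))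
                               (≤-from-agreement-below k f-inc g-inc f⊆g n n<k agree)
      where
        agree : ∀ i → i < n → f i ≡ g i
        agree i i<n = rec i<n (≤-<∞-trans k (<⇒≤ i<n) n<k)

module _ {X : Set} {S : List X → Set} where

  Height⇒inhabited : ∀ {k n} → Height S k → n <∞ k → Σ (List X) (AtLevel S n)
  Height⇒inhabited {ω}     all       _   = all _
  Height⇒inhabited {fin h} (_ , all) n<h = all _ n<h

  Height⇒<∞ : ∀ {k j} → Height S k → (∀ i → i ≤ j → Σ (List X) (AtLevel S i)) → j <∞ k
  Height⇒<∞ {ω}         _                 _       = tt
  Height⇒<∞ {fin h} {j} (nothingAt-h , _) upToJ with suc j ≤? h
  ... | yes j<h = j<h
  ... | no  j≮h = let (a , ah) = upToJ h (≤-pred (≰⇒> j≮h)) in ⊥-elim (nothingAt-h a ah)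

module StrongSubtree {X : Set} (d : X) (_≟_ : DecidableEquality X)
  (T : List X → Set) (T-⊑-closed : ∀ {s t} → s ⊑ t → T t → T s)
  (S : List X → Set) (k : ℕ∞)
  (subtree : IsSubtree T S) (rooted : Rooted S) (balanced : Balanced S)
  (levelsFlat : ∀ n → Σ ℕ λ m → ∀ t → AtLevel S n t → length t ≡ m)
  (branching : ∀ s t → S s → ¬ Maximal S s → ImmSucc T s t → UniqueChildThrough S s t)
  (height : Height S k) where

  open LongestCommonPrefix _≟_

  S⊆T : ∀ {s} → S s → T s
  S⊆T = proj₁ subtree _

  rootNode : List X
  rootNode = proj₁ rooted

  rootNode-IsRoot : IsRoot S rootNode
  rootNode-IsRoot = proj₂ rooted

  rootNode∈S : S rootNode
  rootNode∈S = proj₁ rootNode-IsRoot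

  rootNode-⊑ : ∀ {s} → S s → rootNode ⊑ s
  rootNode-⊑ = proj₂ rootNode-IsRoot _

  rootNode-atLevel : AtLevel S 0 rootNode
  rootNode-atLevel = rootNode∈S , root-level rootNode-IsRoot

  lengthAt : ℕ → ℕ
  lengthAt n = proj₁ (levelsFlat n)

  lengthAt-spec : ∀ {n t} → AtLevel S n t → length t ≡ lengthAt n
  lengthAt-spec = proj₂ (levelsFlat _) _

  level-unique : ∀ {t a b} → LevelIn S t a → LevelIn S t b → a ≡ b
  level-unique (l , ul , hl , refl) (l' , ul' , hl' , refl) =
    unique-length-≡ l l' ul ul' λ z → (λ z∈l → proj₂ (hl' z) (proj₁ (hl z) z∈l))
                                    , (λ z∈l' → proj₂ (hl z) (proj₁ (hl' z) z∈l'))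

  ImmSucc-level : ∀ {u u' i} → AtLevel S i u → ImmSucc S u u' → AtLevel S (suc i) u'
  ImmSucc-level {u} {u'} (Su , l , ul , hl , refl) (Su' , u⊏u' , imm) =
    Su' , u ∷ l , All-tabulate u∉l ∷ ul , below , refl
    where
      u∉l : ∀ {z} → z ∈ l → ¬ (u ≡ z)
      u∉l z∈l refl = ⊏-irrefl (proj₂ (proj₁ (hl u) z∈l))
      below : ∀ s → (s ∈ u ∷ l → S s × s ⊏ u') × (S s × s ⊏ u' → s ∈ u ∷ l)
      below s = to , from
        where
          to : s ∈ u ∷ l → S s × s ⊏ u'
          to (here refl)  = Su , u⊏u'
          to (there s∈l) = let (Ss , s⊏u) = proj₁ (hl s) s∈l in Ss , ⊏-trans s⊏u u⊏u'
          from : S s × s ⊏ u' → s ∈ u ∷ l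
          from (Ss , s⊏u') with ⊑-linear (⊏⇒⊑ s⊏u') (⊏⇒⊑ u⊏u')
          ... | inj₂ u⊏s = ⊥-elim (imm s Ss u⊏s s⊏u')
          ... | inj₁ s⊑u with ⊑⇒≡⊎⊏ s⊑u
          ...   | inj₁ refl = here refl
          ...   | inj₂ s⊏u = there (proj₂ (hl s) (Ss , s⊏u))

  nonMaximal : ∀ {i u} → AtLevel S i u → suc i <∞ k → ¬ Maximal S u
  nonMaximal {i} {u} (_ , lvl) i+1<k max = byBalance balanced
    where
      byBalance : Balanced S → ⊥
      byBalance (inj₁ (_ , noMax)) = noMax u max
      byBalance (inj₂ (h , (nothingAt-h , _) , maxAt)) =
        let h<k = ≤-<∞-trans k (m≤n+m∸n h 1) (subst (λ j → suc j <∞ k) (level-unique lvl (maxAt u max)) i+1<k)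
            (t , at) = Height⇒inhabited height h<k
        in nothingAt-h t at

  -- The T-meet of u' and t lies in S, and extends u ∷ʳ x; immediacy of u' forces it to be u'.
  child-⊑ : ∀ {u u' t x} → S t → ImmSucc S u u' → (u ∷ʳ x) ⊑ u' → (u ∷ʳ x) ⊑ t → u' ⊑ t
  child-⊑ {u} {u'} {t} St (Su' , _ , imm) ux⊑u' ux⊑t with ⊑⇒≡⊎⊏ (lcp-⊑ˡ u' t)
  ... | inj₁ m≡u' = subst (_⊑ t) m≡u' (lcp-⊑ʳ u' t)
  ... | inj₂ m⊏u' = ⊥-elim (imm (lcp u' t) Sm (⊏-⊑-trans ⊏-∷ʳ (lcp-greatest _ u' t ux⊑u' ux⊑t)) m⊏u')
    where
      Sm : S (lcp u' t)
      Sm = proj₁ (proj₂ subtree u' t _ Su' St (lcp-IsMeet T u' t (T-⊑-closed (lcp-⊑ʳ u' t) (S⊆T St))))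

  Ancestry : ℕ → List X → Set
  Ancestry i t = ∀ i' → i' ≤ i → Σ (List X) λ a → AtLevel S i' a × a ⊑ t

  Levelled : List X → Set
  Levelled t = Σ ℕ λ j → LevelIn S t j × Ancestry j t

  private
    -- The fuel bounds |t| - |u|, making the descent structurally recursive.
    descend : ∀ {t} (fuel i : ℕ) (u : List X) → AtLevel S i u → u ⊑ t → length t ≤ length u + fuel →
              Ancestry i u → S t → Levelled t
    descend fuel i u au u⊑t bound anc St with ⊑⇒≡⊎⊏ u⊑t
    ... | inj₁ refl = i , proj₂ au , anc
    descend zero i u au u⊑t bound anc St | inj₂ (_ , lt) =
      contradiction (≤-trans bound (≤-reflexive (+-identityʳ (length u)))) (<⇒≱ lt)
    descend {t} (suc fuel) i u au u⊑t bound anc St | inj₂ u⊏t =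
      descend fuel (suc i) u' au' u'⊑t bound' anc' St
      where
        ux⊑t : (u ∷ʳ nth d t (length u)) ⊑ t
        ux⊑t = ⊏⇒∷ʳ-nth-⊑ d u⊏t
        child : UniqueChildThrough S u (u ∷ʳ nth d t (length u))
        child = branching u _ (proj₁ au) (λ (_ , max) → max t St u⊏t)
                          (∷ʳ-ImmSucc T (T-⊑-closed ux⊑t (S⊆T St)))
        u' : List X
        u' = proj₁ child
        imm : ImmSucc S u u'
        imm = proj₁ (proj₁ (proj₂ child))
        u'⊑t : u' ⊑ t
        u'⊑t = child-⊑ St imm (proj₂ (proj₁ (proj₂ child))) ux⊑t
        au' : AtLevel S (suc i) u'
        au' = ImmSucc-level au imm
        bound' : length t ≤ length u' + fuel
        bound' = ≤-trans bound (≤-trans (≤-reflexive (+-suc (length u) fuel))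
                                        (+-monoˡ-≤ fuel (proj₂ (proj₁ (proj₂ imm)))))
        anc' : Ancestry (suc i) u'
        anc' i' i'≤i+1 with i' ≤? i
        ... | yes i'≤i = let (a , aa , a⊑u) = anc i' i'≤i in a , aa , ⊑-trans a⊑u (⊏⇒⊑ (proj₁ (proj₂ imm)))
        ... | no  i'≰i = u' , subst (λ j → AtLevel S j u') (≤-antisym (≰⇒> i'≰i) i'≤i+1) au' , ⊑-refl

  levelled : ∀ {t} → S t → Levelled t
  levelled {t} St = descend (length t) 0 rootNode rootNode-atLevel (rootNode-⊑ St)
                            (m≤n+m (length t) (length rootNode)) anc0 St
    where
      anc0 : Ancestry 0 rootNode
      anc0 .zero z≤n = rootNode , rootNode-atLevel , ⊑-refl

  ancestor : ∀ {i j t} → AtLevel S j t → i ≤ j → Σ (List X) λ a → AtLevel S i a × a ⊑ t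
  ancestor {i} (St , lj) i≤j with levelled St
  ... | j' , lj' , anc with refl ← level-unique lj lj' = anc i i≤j

  level<height : ∀ {j t} → AtLevel S j t → j <∞ k
  level<height at = Height⇒<∞ height λ i i≤j → let (a , ai , _) = ancestor at i≤j in a , ai

  level-inhabited : ∀ {n} → n <∞ k → Σ (List X) (AtLevel S n)
  level-inhabited = Height⇒inhabited height

  lengthAt-strictMono : ∀ {i j} → i < j → j <∞ k → lengthAt i < lengthAt j
  lengthAt-strictMono {i} i<j j<k with level-inhabited j<k
  ... | t , at with ancestor at (<⇒≤ i<j)
  ... | a , aa , a⊑t with ⊑⇒≡⊎⊏ a⊑t
  ...   | inj₁ refl = ⊥-elim (<-irrefl (level-unique (proj₂ aa) (proj₂ at)) i<j)
  ...   | inj₂ (_ , lt) = subst₂ _<_ (lengthAt-spec aa) (lengthAt-spec at) lt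

  lengthAt-mono : ∀ {i j} → i ≤ j → j <∞ k → lengthAt i ≤ lengthAt j
  lengthAt-mono i≤j j<k with m≤n⇒m<n∨m≡n i≤j
  ... | inj₁ i<j  = <⇒≤ (lengthAt-strictMono i<j j<k)
  ... | inj₂ refl = ≤-refl

  lengthAt-cancel-≤ : ∀ {i j} → i <∞ k → lengthAt i ≤ lengthAt j → i ≤ j
  lengthAt-cancel-≤ {i} {j} i<k le with i ≤? j
  ... | yes i≤j = i≤j
  ... | no  i≰j = contradiction le (<⇒≱ (lengthAt-strictMono (≰⇒> i≰j) i<k))

  lengthAt-cancel-< : ∀ {i j} → i <∞ k → lengthAt i < lengthAt j → i < j
  lengthAt-cancel-< {i} {j} i<k lt with suc i ≤? j
  ... | yes i<j = i<j
  ... | no  i≮j = contradiction (lengthAt-mono (≤-pred (≰⇒> i≮j)) i<k) (<⇒≱ lt)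

  lengthAt-∈-levelSet : ∀ {n} → n <∞ k → InLevelSet S (lengthAt n)
  lengthAt-∈-levelSet n<k = let (t , at) = level-inhabited n<k in t , proj₁ at , lengthAt-spec at

  levelSet-⊆-lengthAt : ∀ {m} → InLevelSet S m → Σ ℕ λ j → j <∞ k × lengthAt j ≡ m
  levelSet-⊆-lengthAt (t , St , refl) =
    let (j , lj , _) = levelled St in j , level<height (St , lj) , sym (lengthAt-spec (St , lj))

  parent : ∀ {n t} → AtLevel S (suc n) t → Σ (List X) λ p → AtLevel S n p × ImmSucc S p t
  parent {n} {t} at with ancestor at (n≤1+n n)
  ... | p , ap , p⊑t = p , ap , proj₁ at , p⊏t , between
    where
      n+1<k : suc n <∞ k
      n+1<k = level<height at
      p⊏t : p ⊏ t
      p⊏t = p⊑t , subst₂ _<_ (sym (lengthAt-spec ap)) (sym (lengthAt-spec at)) (lengthAt-strictMono ≤-refl n+1<k)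
      between : ∀ w → S w → p ⊏ w → ¬ (w ⊏ t)
      between w Sw (_ , p<w) (_ , w<t) = <-irrefl refl (<-≤-trans n<j (≤-pred j<n+1))
        where
          j : ℕ
          j = proj₁ (levelled Sw)
          aw : AtLevel S j w
          aw = Sw , proj₁ (proj₂ (levelled Sw))
          n<j : n < j
          n<j = lengthAt-cancel-< (≤-<∞-trans k (n≤1+n n) n+1<k)
                  (subst₂ _<_ (lengthAt-spec ap) (lengthAt-spec aw) p<w)
          j<n+1 : j < suc n
          j<n+1 = lengthAt-cancel-< (level<height aw) (subst₂ _<_ (lengthAt-spec aw) (lengthAt-spec at) w<t)

  level0⇒rootNode : ∀ {t} → AtLevel S 0 t → t ≡ rootNode
  level0⇒rootNode (St , [] , _ , hl , _) with ⊑⇒≡⊎⊏ (rootNode-⊑ St)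
  ... | inj₁ r≡t = sym r≡t
  ... | inj₂ r⊏t with () ← proj₂ (hl rootNode) (rootNode∈S , r⊏t)

  children-≡ : ∀ {p t t'} → S p → ImmSucc S p t → ImmSucc S p t' →
               nth d t (length p) ≡ nth d t' (length p) → t ≡ t'
  children-≡ {p} {t} {t'} Sp immt immt' same = trans (unique t immt px⊑t) (sym (unique t' immt' px⊑t'))
    where
      x : X
      x = nth d t (length p)
      px⊑t : (p ∷ʳ x) ⊑ t
      px⊑t = ⊏⇒∷ʳ-nth-⊑ d (proj₁ (proj₂ immt))
      px⊑t' : (p ∷ʳ x) ⊑ t'
      px⊑t' = subst (λ z → (p ∷ʳ z) ⊑ t') (sym same) (⊏⇒∷ʳ-nth-⊑ d (proj₁ (proj₂ immt')))
      through : UniqueChildThrough S p (p ∷ʳ x)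
      through = branching p (p ∷ʳ x) Sp (λ (_ , max) → max t (proj₁ immt) (proj₁ (proj₂ immt)))
                          (∷ʳ-ImmSucc T (T-⊑-closed px⊑t (S⊆T (proj₁ immt))))
      unique : ∀ u' → ImmSucc S p u' → (p ∷ʳ x) ⊑ u' → u' ≡ proj₁ through
      unique = proj₂ (proj₂ through)

  ≡-by-entries : ∀ n {t t'} → AtLevel S n t → AtLevel S n t' →
                 (∀ i → i < n → nth d t (lengthAt i) ≡ nth d t' (lengthAt i)) → t ≡ t'
  ≡-by-entries zero    at at' _ = trans (level0⇒rootNode at) (sym (level0⇒rootNode at'))
  ≡-by-entries (suc n) {t} {t'} at at' same = siblings (parent at) (parent at')
    where
      n<k : n <∞ k
      n<k = ≤-<∞-trans k (n≤1+n n) (level<height at)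
      entry-⊏ : ∀ {q u} → AtLevel S n q → q ⊏ u → ∀ i → i < n → nth d q (lengthAt i) ≡ nth d u (lengthAt i)
      entry-⊏ aq q⊏u i i<n = nth-⊑ d (⊏⇒⊑ q⊏u) (lengthAt i)
        (subst (lengthAt i <_) (sym (lengthAt-spec aq)) (lengthAt-strictMono i<n n<k))
      siblings : (Σ (List X) λ p → AtLevel S n p × ImmSucc S p t) →
                 (Σ (List X) λ p → AtLevel S n p × ImmSucc S p t') → t ≡ t'
      siblings (p , ap , immt) (p' , ap' , immt') =
        children-≡ (proj₁ ap) immt (subst (λ q → ImmSucc S q t') p'≡p immt')
          (subst (λ z → nth d t z ≡ nth d t' z) (sym (lengthAt-spec ap)) (same n ≤-refl))
        where
          p'≡p : p' ≡ p
          p'≡p = ≡-by-entries n ap' ap λ i i<n →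
            trans (entry-⊏ ap' (proj₁ (proj₂ immt')) i i<n)
                  (trans (sym (same i (≤-trans i<n (n≤1+n n)))) (sym (entry-⊏ ap (proj₁ (proj₂ immt)) i i<n)))

  realise : (∀ v x → T (v ∷ʳ x)) → (β : ℕ → X) → ∀ n → n <∞ k →
            Σ (List X) λ v → AtLevel S n v × (∀ j → j < n → nth d v (lengthAt j) ≡ β j)
  realise T-full β zero    _     = rootNode , rootNode-atLevel , λ _ ()
  realise T-full β (suc n) n+1<k with realise T-full β n (≤-<∞-trans k (n≤1+n n) n+1<k)
  ... | v , av , hv = v' , av' , hv'
    where
      child : UniqueChildThrough S v (v ∷ʳ β n)
      child = branching v (v ∷ʳ β n) (proj₁ av) (nonMaximal av n+1<k) (∷ʳ-ImmSucc T (T-full v (β n)))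
      v' : List X
      v' = proj₁ child
      imm : ImmSucc S v v'
      imm = proj₁ (proj₁ (proj₂ child))
      av' : AtLevel S (suc n) v'
      av' = ImmSucc-level av imm
      hv' : ∀ j → j < suc n → nth d v' (lengthAt j) ≡ β j
      hv' j j<n+1 with m≤n⇒m<n∨m≡n (≤-pred j<n+1)
      ... | inj₁ j<n = trans (sym (nth-⊑ d (⊏⇒⊑ (proj₁ (proj₂ imm))) (lengthAt j)
                         (subst (lengthAt j <_) (sym (lengthAt-spec av))
                                (lengthAt-strictMono j<n (≤-<∞-trans k (n≤1+n n) n+1<k)))))
                         (hv j j<n)
      ... | inj₂ refl = subst (λ z → nth d v' z ≡ β j) (lengthAt-spec av) (∷ʳ-⊑⇒nth d (proj₂ (proj₁ (proj₂ child))))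

T₂-⊑-closed : ∀ {s t : Mat} → s ⊑ t → T₂ t → T₂ s
T₂-⊑-closed = RowsOK-⊑

T₂-entry-≥ : ∀ {A} → T₂ A → ∀ b a → b ≤ a → entry A b a ≡ false
T₂-entry-≥ {A} T₂A b a b≤a with length A ≤? b
... | yes A≤b = cong (λ row → nth false row a) (nth-≥length [] A b A≤b)
... | no  A≰b = nth-≥length false (nth [] A b) a
                  (subst (_≤ a) (sym (RowsOK-row-length 0 A b (≰⇒> A≰b) T₂A)) b≤a)

T₂-ext : ∀ {A A'} → T₂ A → T₂ A' → length A ≡ length A' →
         (∀ b a → a < b → b < length A → entry A b a ≡ entry A' b a) → A ≡ A'
T₂-ext {A} {A'} T₂A T₂A' |A|≡|A'| same = nth-ext [] A A' |A|≡|A'| λ b b<|A| →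
  let |row|≡b = RowsOK-row-length 0 A b b<|A| T₂A
  in nth-ext false _ _ (trans |row|≡b (sym (RowsOK-row-length 0 A' b (subst (b <_) |A|≡|A'| b<|A|) T₂A')))
       λ a a<|row| → same b a (subst (a <_) |row|≡b a<|row|) b<|A|

Below-⊑ : ∀ k {A B} → Below k B → A ⊑ B → Below k A
Below-⊑ k (T₂B , B<k) A⊑B = T₂-⊑-closed A⊑B T₂B , ≤-<∞-trans k (⊑⇒length≤ A⊑B) B<k

Val⇒S₂ : ∀ {S₁ S₂ A} → Val S₁ S₂ A → S₂ A
Val⇒S₂ (root r)            = proj₁ r
Val⇒S₂ (step _ _ _ imm _) = proj₁ imm

HasUniqueStructIso : ℕ∞ → (Mat → Set) → Set
HasUniqueStructIso k T =
  Σ (Mat → Mat) (IsStructIso k T) ×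
  (∀ f g → IsStructIso k T f → IsStructIso k T g → ∀ A → Below k A → f A ≡ g A)

module Valuation
  (k : ℕ∞) (T : Mat → Set) (k' : ℕ∞) (S₁ : Vect → Set) (S₂ : Mat → Set)
  (subtree₁ : IsSubtree T₁ S₁) (rooted₁ : Rooted S₁) (balanced₁ : Balanced S₁)
  (levelsFlat₁ : ∀ n → Σ ℕ λ m → ∀ t → AtLevel S₁ n t → length t ≡ m)
  (branching₁ : ∀ s t → S₁ s → ¬ Maximal S₁ s → ImmSucc T₁ s t → UniqueChildThrough S₁ s t)
  (subtree₂ : IsSubtree T₂ S₂) (rooted₂ : Rooted S₂) (balanced₂ : Balanced S₂)
  (levelsFlat₂ : ∀ n → Σ ℕ λ m → ∀ t → AtLevel S₂ n t → length t ≡ m)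
  (branching₂ : ∀ s t → S₂ s → ¬ Maximal S₂ s → ImmSucc T₂ s t → UniqueChildThrough S₂ s t)
  (height₁ : Height S₁ k') (height₂ : Height S₂ k')
  (sameLevels : ∀ n → (InLevelSet S₁ n → InLevelSet S₂ n) × (InLevelSet S₂ n → InLevelSet S₁ n))
  (T⇔Val : ∀ A → (T A → Val S₁ S₂ A) × (Val S₁ S₂ A → T A)) (heightT : Height T k) where

  open ≡-Reasoning

  module V = StrongSubtree false Bool._≟_ T₁ (λ _ _ → tt) S₁ k'
               subtree₁ rooted₁ balanced₁ levelsFlat₁ branching₁ height₁
  module M = StrongSubtree [] (≡-dec Bool._≟_) T₂ T₂-⊑-closed S₂ k'
               subtree₂ rooted₂ balanced₂ levelsFlat₂ branching₂ height₂

  lengthAt-≡ : ∀ n → n <∞ k' → V.lengthAt n ≡ M.lengthAt n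
  lengthAt-≡ = strictlyIncreasing-sameRange⇒≡ k' V.lengthAt-strictMono M.lengthAt-strictMono
    (λ n n<k' → M.levelSet-⊆-lengthAt (proj₁ (sameLevels _) (V.lengthAt-∈-levelSet n<k')))
    (λ n n<k' → V.levelSet-⊆-lengthAt (proj₂ (sameLevels _) (M.lengthAt-∈-levelSet n<k')))

  T⇒Val : ∀ {A} → T A → Val S₁ S₂ A
  T⇒Val = proj₁ (T⇔Val _)

  Val⇒T : ∀ {A} → Val S₁ S₂ A → T A
  Val⇒T = proj₂ (T⇔Val _)

  Val-⊏-closed : ∀ {C w} → Val S₁ S₂ C → S₂ w → w ⊏ C → Val S₁ S₂ w
  Val-⊏-closed (root (_ , r⊑)) Sw (_ , lt) = contradiction (⊑⇒length≤ (r⊑ _ Sw)) (<⇒≱ lt)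
  Val-⊏-closed (step vA _ _ (_ , A⊏C , imm) _) Sw w⊏C with ⊑-linear (⊏⇒⊑ w⊏C) (⊏⇒⊑ A⊏C)
  ... | inj₂ A⊏w = ⊥-elim (imm _ Sw A⊏w w⊏C)
  ... | inj₁ w⊑A with ⊑⇒≡⊎⊏ w⊑A
  ...   | inj₁ refl = vA
  ...   | inj₂ w⊏A = Val-⊏-closed vA Sw w⊏A

  Val-ancestor : ∀ {C i j} → Val S₁ S₂ C → LevelIn S₂ C j → i ≤ j → Σ Mat λ a → Val S₁ S₂ a × AtLevel S₂ i a
  Val-ancestor vC lj i≤j with M.ancestor (Val⇒S₂ vC , lj) i≤j
  ... | a , aa , a⊑C with ⊑⇒≡⊎⊏ a⊑C
  ...   | inj₁ refl = a , vC , aa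
  ...   | inj₂ a⊏C = a , Val-⊏-closed vC (proj₁ aa) a⊏C , aa

  LevelIn-S₂⇒T : ∀ {C j} → Val S₁ S₂ C → LevelIn S₂ C j → LevelIn T C j
  LevelIn-S₂⇒T {C} vC (l , ul , hl , el) = l , ul , (λ s → to s , from s) , el
    where
      to : ∀ s → s ∈ l → T s × s ⊏ C
      to s s∈l = let (Ss , s⊏C) = proj₁ (hl s) s∈l in Val⇒T (Val-⊏-closed vC Ss s⊏C) , s⊏C
      from : ∀ s → T s × s ⊏ C → s ∈ l
      from s (Ts , s⊏C) = proj₂ (hl s) (Val⇒S₂ (T⇒Val Ts) , s⊏C)

  LevelIn-T⇒S₂ : ∀ {C j} → Val S₁ S₂ C → LevelIn T C j → LevelIn S₂ C j
  LevelIn-T⇒S₂ {C} vC (l , ul , hl , el) = l , ul , (λ s → to s , from s) , el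
    where
      to : ∀ s → s ∈ l → S₂ s × s ⊏ C
      to s s∈l = let (Ts , s⊏C) = proj₁ (hl s) s∈l in Val⇒S₂ (T⇒Val Ts) , s⊏C
      from : ∀ s → S₂ s × s ⊏ C → s ∈ l
      from s (Ss , s⊏C) = proj₂ (hl s) (Val⇒T (Val-⊏-closed vC Ss s⊏C) , s⊏C)

  <k⇒<k' : ∀ {n} → n <∞ k → n <∞ k'
  <k⇒<k' n<k = let (C , TC , lC) = Height⇒inhabited heightT n<k
               in M.level<height (Val⇒S₂ (T⇒Val TC) , LevelIn-T⇒S₂ (T⇒Val TC) lC)

  Val-level<k : ∀ {C j} → Val S₁ S₂ C → LevelIn S₂ C j → j <∞ k
  Val-level<k vC lj = Height⇒<∞ heightT λ i i≤j →
    let (a , va , Sa , la) = Val-ancestor vC lj i≤j in a , Val⇒T va , LevelIn-S₂⇒T va la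

  record Position : Set where
    constructor position
    field
      level        : ℕ
      node         : Mat
      node∈Val     : Val S₁ S₂ node
      node-atLevel : AtLevel S₂ level node
  open Position

  -- The row ρ selects the S₁-vector at the current level whose entries at the splitting
  -- positions spell ρ, and then the S₂-child through node ⌢ vector.
  module Child (s : Position) (p : suc (level s) <∞ k') (ρ : Vect) where

    private
      level<k' : level s <∞ k'
      level<k' = ≤-<∞-trans k' (n≤1+n _) p
      realised : Σ Vect λ v → AtLevel S₁ (level s) v × (∀ j → j < level s → nth false v (V.lengthAt j) ≡ nth false ρ j)
      realised = V.realise (λ _ _ → tt) (nth false ρ) (level s) level<k'

    vector : Vect
    vector = proj₁ realised

    vector-atLevel : AtLevel S₁ (level s) vector
    vector-atLevel = proj₁ (proj₂ realised)

    vector-entries : ∀ j → j < level s → nth false vector (V.lengthAt j) ≡ nth false ρ j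
    vector-entries = proj₂ (proj₂ realised)

    length-vector : length vector ≡ length (node s)
    length-vector = trans (V.lengthAt-spec vector-atLevel)
                          (trans (lengthAt-≡ (level s) level<k') (sym (M.lengthAt-spec (node-atLevel s))))

    private
      extension : UniqueChildThrough S₂ (node s) (node s ∷ʳ vector)
      extension = branching₂ (node s) (node s ∷ʳ vector) (proj₁ (node-atLevel s)) (M.nonMaximal (node-atLevel s) p)
                    (∷ʳ-ImmSucc T₂ (RowsOK-∷ʳ⁺ 0 (node s) vector (M.S⊆T (proj₁ (node-atLevel s))) length-vector))

    childNode : Mat
    childNode = proj₁ extension

    childNode-ImmSucc : ImmSucc S₂ (node s) childNode
    childNode-ImmSucc = proj₁ (proj₁ (proj₂ extension))

    childNode-through : (node s ∷ʳ vector) ⊑ childNode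
    childNode-through = proj₂ (proj₁ (proj₂ extension))

    childNode-unique : ∀ u → ImmSucc S₂ (node s) u → (node s ∷ʳ vector) ⊑ u → u ≡ childNode
    childNode-unique = proj₂ (proj₂ extension)

    childNode-row : nth [] childNode (length (node s)) ≡ vector
    childNode-row = ∷ʳ-⊑⇒nth [] childNode-through

    child : Position
    child = position (suc (level s)) childNode
              (step (node∈Val s) (proj₂ (node-atLevel s)) vector-atLevel childNode-ImmSucc childNode-through)
              (M.ImmSucc-level (node-atLevel s) childNode-ImmSucc)

  advanceIf : (s : Position) → Dec (suc (level s) <∞ k') → Vect → Position
  advanceIf s (yes p) = Child.child s p
  advanceIf s (no _)  _ = s

  advance : Position → Vect → Position
  advance s = advanceIf s (suc (level s) <∞? k')

  walk : Position → Mat → Position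
  walk s []       = s
  walk s (ρ ∷ A) = walk (advance s ρ) A

  start : Position
  start = position 0 M.rootNode (root M.rootNode-IsRoot) M.rootNode-atLevel

  embed : Mat → Mat
  embed A = node (walk start A)

  walk-++ : ∀ s (A B : Mat) → walk s (A ++ B) ≡ walk (walk s A) B
  walk-++ s []      B = refl
  walk-++ s (ρ ∷ A) B = walk-++ (advance s ρ) A B

  AdvancesToChild : Position → Vect → Set
  AdvancesToChild s ρ = Σ (suc (level s) <∞ k') λ q → advance s ρ ≡ Child.child s q ρ

  advance-child : ∀ s ρ → suc (level s) <∞ k' → AdvancesToChild s ρ
  advance-child s ρ p = byDecision (suc (level s) <∞? k')
    where
      byDecision : (dec : Dec (suc (level s) <∞ k')) → Σ (suc (level s) <∞ k') λ q → advanceIf s dec ρ ≡ Child.child s q ρ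
      byDecision (yes q) = q , refl
      byDecision (no ¬p) = contradiction p ¬p

  walk-⊑ : ∀ s A → node s ⊑ node (walk s A)
  walk-⊑ s []      = ⊑-refl
  walk-⊑ s (ρ ∷ A) = ⊑-trans (advance-⊑ (suc (level s) <∞? k')) (walk-⊑ (advance s ρ) A)
    where
      advance-⊑ : (dec : Dec (suc (level s) <∞ k')) → node s ⊑ node (advanceIf s dec ρ)
      advance-⊑ (yes p) = ⊏⇒⊑ (proj₁ (proj₂ (Child.childNode-ImmSucc s p ρ)))
      advance-⊑ (no _)  = ⊑-refl

  walk-level : ∀ s A → (level s + length A) <∞ k' → level (walk s A) ≡ level s + length A
  walk-level s []      _ = sym (+-identityʳ (level s))
  walk-level s (ρ ∷ A) p =
    trans (cong (λ z → level (walk z A)) (proj₂ advanced))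
          (trans (walk-level (Child.child s (proj₁ advanced) ρ) A (subst (_<∞ k') (+-suc (level s) (length A)) p))
                 (sym (+-suc (level s) (length A))))
    where
      advanced : AdvancesToChild s ρ
      advanced = advance-child s ρ (≤-<∞-trans k' (≤-trans (s≤s (m≤m+n (level s) (length A)))
                                                          (≤-reflexive (sym (+-suc (level s) (length A))))) p)

  embed-level : ∀ {A} → Below k A → level (walk start A) ≡ length A
  embed-level {A} (_ , A<k) = walk-level start A (<k⇒<k' A<k)

  embed-atLevel : ∀ {A} → Below k A → AtLevel S₂ (length A) (embed A)
  embed-atLevel {A} b = subst (λ n → AtLevel S₂ n (embed A)) (embed-level b) (node-atLevel (walk start A))

  length-embed : ∀ {A} → Below k A → length (embed A) ≡ M.lengthAt (length A)
  length-embed b = M.lengthAt-spec (embed-atLevel b)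

  embed-Val : ∀ A → Val S₁ S₂ (embed A)
  embed-Val A = node∈Val (walk start A)

  embed-⊑ : ∀ {A B} → A ⊑ B → embed A ⊑ embed B
  embed-⊑ {A} (u , refl) = subst (λ s → embed A ⊑ node s) (sym (walk-++ start A u)) (walk-⊑ (walk start A) u)

  EmbedsAsChild : Mat → Vect → Set
  EmbedsAsChild A ρ = Σ (suc (level (walk start A)) <∞ k') λ q → embed (A ∷ʳ ρ) ≡ Child.childNode (walk start A) q ρ

  embed-∷ʳ : ∀ A ρ → Below k (A ∷ʳ ρ) → EmbedsAsChild A ρ
  embed-∷ʳ A ρ b = proj₁ advanced , cong node (trans (walk-++ start A (ρ ∷ [])) (proj₂ advanced))
    where
      advanced : AdvancesToChild (walk start A) ρ
      advanced = advance-child (walk start A) ρ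
        (subst (_<∞ k') (sym (trans (cong suc (embed-level (Below-⊑ k b (ρ ∷ [] , refl)))) (sym (length-∷ʳ A ρ))))
               (<k⇒<k' (proj₂ b)))

  embed-entry-< : ∀ C {a b} → Below k C → a < b → b < length C →
                  entry (embed C) (M.lengthAt b) (M.lengthAt a) ≡ entry C b a
  embed-entry-< C {a} {b} bC a<b b<|C| = begin
      nth false (nth [] (embed C) (M.lengthAt b)) (M.lengthAt a)
    ≡⟨ cong (λ row → nth false row (M.lengthAt a)) embed-row ⟩
      nth false vector (M.lengthAt a)
    ≡⟨ cong (nth false vector) (sym (lengthAt-≡ a (<k⇒<k' (≤-<∞-trans k (<⇒≤ (<-trans a<b b<|C|)) (proj₂ bC))))) ⟩
      nth false vector (V.lengthAt a)
    ≡⟨ vector-entries a (subst (a <_) (sym (embed-level bC₀)) (subst (a <_) (sym |C₀|≡b) a<b)) ⟩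
      nth false ρ a
    ∎
    where
      C₀ : Mat
      C₀ = take b C
      ρ : Vect
      ρ = nth [] C b
      C₀ρ⊑C : (C₀ ∷ʳ ρ) ⊑ C
      C₀ρ⊑C = subst (_⊑ C) (take-suc [] b C b<|C|) (take-⊑ (suc b) C)
      bC₀ : Below k C₀
      bC₀ = Below-⊑ k bC (take-⊑ b C)
      |C₀|≡b : length C₀ ≡ b
      |C₀|≡b = length-take-≤ b C (<⇒≤ b<|C|)
      extended : EmbedsAsChild C₀ ρ
      extended = embed-∷ʳ C₀ ρ (Below-⊑ k bC C₀ρ⊑C)
      open Child (walk start C₀) (proj₁ extended) ρ
      |node|≡ℓb : length (embed C₀) ≡ M.lengthAt b
      |node|≡ℓb = trans (length-embed bC₀) (cong M.lengthAt |C₀|≡b)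
      embed-row : nth [] (embed C) (M.lengthAt b) ≡ vector
      embed-row = begin
          nth [] (embed C) (M.lengthAt b)
        ≡⟨ sym (nth-⊑ [] (embed-⊑ C₀ρ⊑C) (M.lengthAt b)
                 (subst₂ _<_ |node|≡ℓb (cong length (sym (proj₂ extended))) (proj₂ (proj₁ (proj₂ childNode-ImmSucc))))) ⟩
          nth [] (embed (C₀ ∷ʳ ρ)) (M.lengthAt b)
        ≡⟨ cong₂ (nth []) (proj₂ extended) (sym |node|≡ℓb) ⟩
          nth [] childNode (length (embed C₀))
        ≡⟨ childNode-row ⟩
          vector
        ∎

  embed-entry : ∀ C {a b} → Below k C → a ≤ b → b < length C →
                entry (embed C) (M.lengthAt b) (M.lengthAt a) ≡ entry C b a
  embed-entry C {a} bC a≤b b<|C| with m≤n⇒m<n∨m≡n a≤b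
  ... | inj₁ a<b  = embed-entry-< C bC a<b b<|C|
  ... | inj₂ refl = trans (T₂-entry-≥ (M.S⊆T (Val⇒S₂ (embed-Val C))) _ _ ≤-refl)
                          (sym (T₂-entry-≥ (proj₁ bC) a a ≤-refl))

  embed-injective-≡length : ∀ {A A'} → Below k A → Below k A' → length A ≡ length A' → embed A ≡ embed A' → A ≡ A'
  embed-injective-≡length {A} {A'} bA bA' |A|≡|A'| e = T₂-ext (proj₁ bA) (proj₁ bA') |A|≡|A'| λ b a a<b b<|A| →
    trans (sym (embed-entry-< A bA a<b b<|A|))
          (trans (cong (λ E → entry E (M.lengthAt b) (M.lengthAt a)) e)
                 (embed-entry-< A' bA' a<b (subst (b <_) |A|≡|A'| b<|A|)))

  embed-length-≤ : ∀ {A B} → Below k A → Below k B → length A ≤ length B → length (embed A) ≤ length (embed B)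
  embed-length-≤ bA bB le =
    subst₂ _≤_ (sym (length-embed bA)) (sym (length-embed bB)) (M.lengthAt-mono le (<k⇒<k' (proj₂ bB)))

  embed-length-≤⁻ : ∀ {A B} → Below k A → Below k B → length (embed A) ≤ length (embed B) → length A ≤ length B
  embed-length-≤⁻ bA bB le = M.lengthAt-cancel-≤ (<k⇒<k' (proj₂ bA)) (subst₂ _≤_ (length-embed bA) (length-embed bB) le)

  embed-injective : ∀ {A B} → Below k A → Below k B → embed A ≡ embed B → A ≡ B
  embed-injective bA bB e = embed-injective-≡length bA bB
    (≤-antisym (embed-length-≤⁻ bA bB (≤-reflexive (cong length e)))
               (embed-length-≤⁻ bB bA (≤-reflexive (cong length (sym e))))) e

  embed-⊑⁻ : ∀ {A B} → Below k A → Below k B → embed A ⊑ embed B → A ⊑ B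
  embed-⊑⁻ {A} {B} bA bB eA⊑eB = subst (_⊑ B) (sym A≡A') (take-⊑ (length A) B)
    where
      A' : Mat
      A' = take (length A) B
      bA' : Below k A'
      bA' = Below-⊑ k bB (take-⊑ (length A) B)
      |A'|≡|A| : length A' ≡ length A
      |A'|≡|A| = length-take-≤ (length A) B (embed-length-≤⁻ bA bB (⊑⇒length≤ eA⊑eB))
      A≡A' : A ≡ A'
      A≡A' = embed-injective bA bA' (⊑-≡-length eA⊑eB (embed-⊑ (take-⊑ (length A) B))
               (trans (length-embed bA) (trans (cong M.lengthAt (sym |A'|≡|A|)) (sym (length-embed bA')))))

  embed-surjective : ∀ C → Val S₁ S₂ C → Σ Mat λ A → Below k A × embed A ≡ C
  embed-surjective C (root r) =
    [] , (tt , Val-level<k (root r) (root-level r)) , ⊑∧length≥⇒≡ (M.rootNode-⊑ (proj₁ r)) (⊑⇒length≤ (proj₂ r _ M.rootNode∈S))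
  embed-surjective C (step {A} {v} {C} {n} vA lA av imm through)
    with embed-surjective A vA
  ... | A₀ , bA₀ , refl = A₀ ∷ʳ ρ , bA₀ρ , trans (proj₂ extended) (sym C≡childNode)
    where
      |A₀|≡n : length A₀ ≡ n
      |A₀|≡n = M.level-unique (proj₂ (embed-atLevel bA₀)) lA
      level≡n : level (walk start A₀) ≡ n
      level≡n = trans (embed-level bA₀) |A₀|≡n
      ρ : Vect
      ρ = tabulateℕ n (λ j → nth false v (V.lengthAt j))
      bA₀ρ : Below k (A₀ ∷ʳ ρ)
      bA₀ρ = RowsOK-∷ʳ⁺ 0 A₀ ρ (proj₁ bA₀) (trans (length-tabulateℕ n _) (sym |A₀|≡n))
           , subst (_<∞ k) (sym (trans (length-∷ʳ A₀ ρ) (cong suc |A₀|≡n)))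
                   (Val-level<k (step vA lA av imm through) (proj₂ (M.ImmSucc-level (Val⇒S₂ vA , lA) imm)))
      extended : EmbedsAsChild A₀ ρ
      extended = embed-∷ʳ A₀ ρ bA₀ρ
      open Child (walk start A₀) (proj₁ extended) ρ
      vector≡v : vector ≡ v
      vector≡v = V.≡-by-entries n (subst (λ i → AtLevel S₁ i vector) level≡n vector-atLevel) av λ j j<n →
        trans (vector-entries j (subst (j <_) (sym level≡n) j<n)) (nth-tabulateℕ n _ j j<n)
      C≡childNode : C ≡ childNode
      C≡childNode = childNode-unique C imm (subst (λ w → (embed A₀ ∷ʳ w) ⊑ C) (sym vector≡v) through)

  embed-IsStructIso : IsStructIso k T embed
  embed-IsStructIso =
      (λ A _ → Val⇒T (embed-Val A))
    , (λ A B → embed-injective)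
    , (λ C TC → embed-surjective C (T⇒Val TC))
    , (λ A B bA bB → embed-⊑ , embed-⊑⁻ bA bB)
    , (λ A B bA bB → embed-length-≤ bA bB , embed-length-≤⁻ bA bB)
    , λ A B C bA bB bC |A|≤|B| |B|<|C| →
        subst₂ (λ x y → entry (embed C) x y ≡ entry C (length B) (length A)) (sym (length-embed bB)) (sym (length-embed bA))
               (embed-entry C bC |A|≤|B| |B|<|C|)

  Val-child-row : ∀ {X Y n} → AtLevel S₂ n X → Val S₁ S₂ Y → ImmSucc S₂ X Y → AtLevel S₁ n (nth [] Y (length X))
  Val-child-row (SX , _) (root (_ , r⊑)) (_ , (_ , X<Y) , _) = contradiction (⊑⇒length≤ (r⊑ _ SX)) (<⇒≱ X<Y)
  Val-child-row {n = n} (SX , lX) (step vP lP av immP through) immX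
    with refl ← ImmSucc-unique-pred S₂ (Val⇒S₂ vP) SX immP immX
    with refl ← M.level-unique lP lX = subst (AtLevel S₁ n) (sym (∷ʳ-⊑⇒nth [] through)) av

  module StructIso (g : Mat → Mat) (iso : IsStructIso k T g) where

    ∈T : ∀ A → Below k A → T (g A)
    ∈T = proj₁ iso

    surjective : ∀ C → T C → Σ Mat λ A → Below k A × g A ≡ C
    surjective = proj₁ (proj₂ (proj₂ iso))

    ⊑⁺ : ∀ {A B} → Below k A → Below k B → A ⊑ B → g A ⊑ g B
    ⊑⁺ bA bB = proj₁ (proj₁ (proj₂ (proj₂ (proj₂ iso))) _ _ bA bB)

    length-≤⁺ : ∀ {A B} → Below k A → Below k B → length A ≤ length B → length (g A) ≤ length (g B)
    length-≤⁺ bA bB = proj₁ (proj₁ (proj₂ (proj₂ (proj₂ (proj₂ iso)))) _ _ bA bB)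

    length-≤⁻ : ∀ {A B} → Below k A → Below k B → length (g A) ≤ length (g B) → length A ≤ length B
    length-≤⁻ bA bB = proj₂ (proj₁ (proj₂ (proj₂ (proj₂ (proj₂ iso)))) _ _ bA bB)

    entry-preserved : ∀ A B C → Below k A → Below k B → Below k C → length A ≤ length B → length B < length C →
                      entry (g C) (length (g B)) (length (g A)) ≡ entry C (length B) (length A)
    entry-preserved = proj₂ (proj₂ (proj₂ (proj₂ (proj₂ iso))))

    length-<⁺ : ∀ {A B} → Below k A → Below k B → length A < length B → length (g A) < length (g B)
    length-<⁺ {A} {B} bA bB lt with suc (length (g A)) ≤? length (g B)
    ... | yes gA<gB = gA<gB
    ... | no  gA≮gB = contradiction (length-≤⁻ bB bA (≤-pred (≰⇒> gA≮gB))) (<⇒≱ lt)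

    length-<⁻ : ∀ {A B} → Below k A → Below k B → length (g A) < length (g B) → length A < length B
    length-<⁻ {A} {B} bA bB lt with suc (length A) ≤? length B
    ... | yes A<B = A<B
    ... | no  A≮B = contradiction (length-≤⁺ bB bA (≤-pred (≰⇒> A≮B))) (<⇒≱ lt)

    root-image : Below k [] → g [] ≡ M.rootNode
    root-image b[] = ⊑∧length≥⇒≡ g[]⊑root (⊑⇒length≤ (M.rootNode-⊑ (Val⇒S₂ (T⇒Val (∈T [] b[])))))
      where
        preimage : Σ Mat λ D → Below k D × g D ≡ M.rootNode
        preimage = surjective M.rootNode (Val⇒T (root M.rootNode-IsRoot))
        g[]⊑root : g [] ⊑ M.rootNode
        g[]⊑root = subst (g [] ⊑_) (proj₂ (proj₂ preimage)) (⊑⁺ b[] (proj₁ (proj₂ preimage)) (_ , refl))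

    ∷ʳ-ImmSucc-image : ∀ {A ρ} → Below k (A ∷ʳ ρ) → ImmSucc S₂ (g A) (g (A ∷ʳ ρ))
    ∷ʳ-ImmSucc-image {A} {ρ} b = Val⇒S₂ (T⇒Val (∈T _ b)) , (⊑⁺ bA b (ρ ∷ [] , refl) , length-<⁺ bA b |A|<|Aρ|) , between
      where
        bA : Below k A
        bA = Below-⊑ k b (ρ ∷ [] , refl)
        |A|<|Aρ| : length A < length (A ∷ʳ ρ)
        |A|<|Aρ| = ≤-reflexive (sym (length-∷ʳ A ρ))
        between : ∀ w → S₂ w → g A ⊏ w → ¬ (w ⊏ g (A ∷ʳ ρ))
        between w Sw (_ , gA<w) w⊏gAρ with surjective w (Val⇒T (Val-⊏-closed (T⇒Val (∈T _ b)) Sw w⊏gAρ))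
        ... | D , bD , refl = <-irrefl refl
          (<-≤-trans (length-<⁻ bA bD gA<w) (≤-pred (<-≤-trans (length-<⁻ bD b (proj₂ w⊏gAρ)) (≤-reflexive (length-∷ʳ A ρ)))))

    row-entry : ∀ {A ρ j} → Below k (A ∷ʳ ρ) → j < length A →
                nth false (nth [] (g (A ∷ʳ ρ)) (length (g A))) (length (g (take j A))) ≡ nth false ρ j
    row-entry {A} {ρ} {j} b j<|A| =
      trans (entry-preserved (take j A) A (A ∷ʳ ρ) (Below-⊑ k bA (take-⊑ j A)) bA b
                             (≤-trans (≤-reflexive |Aj|≡j) (<⇒≤ j<|A|)) (≤-reflexive (sym (length-∷ʳ A ρ))))
            (cong₂ (nth false) (nth-∷ʳ [] A ρ) |Aj|≡j)
      where
        bA : Below k A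
        bA = Below-⊑ k b (ρ ∷ [] , refl)
        |Aj|≡j : length (take j A) ≡ j
        |Aj|≡j = length-take-≤ j A (<⇒≤ j<|A|)

  module E = StructIso embed embed-IsStructIso

  -- Induction on |A|: g A and embed A are children of the same node whose rows there are S₁-vectors
  -- with the same entries at the splitting positions, because both isomorphisms preserve entries.
  structIso≡embed : (g : Mat → Mat) → IsStructIso k T g → ∀ A → Below k A → g A ≡ embed A
  structIso≡embed g iso A = <-rec P agreeAt (length A) A refl
    where
      module G = StructIso g iso
      P : ℕ → Set
      P n = ∀ A → length A ≡ n → Below k A → g A ≡ embed A
      agreeAt : ∀ n → (∀ {m} → m < n → P m) → P n
      agreeAt _ rec A refl bA with initLast A
      ... | []       = trans (G.root-image bA) (sym (E.root-image bA))
      ... | A' ∷ʳ′ ρ = M.children-≡ (proj₁ aX) immg imme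
                         (V.≡-by-entries (length A') (Val-child-row aX (T⇒Val (G.∈T _ bA)) immg)
                                                     (Val-child-row aX (embed-Val (A' ∷ʳ ρ)) imme) sameEntries)
        where
          ih : ∀ B → length B ≤ length A' → Below k B → g B ≡ embed B
          ih B |B|≤|A'| = rec (≤-trans (s≤s |B|≤|A'|) (≤-reflexive (sym (length-∷ʳ A' ρ)))) B refl
          bA' : Below k A'
          bA' = Below-⊑ k bA (ρ ∷ [] , refl)
          aX : AtLevel S₂ (length A') (embed A')
          aX = embed-atLevel bA'
          immg : ImmSucc S₂ (embed A') (g (A' ∷ʳ ρ))
          immg = subst (λ Z → ImmSucc S₂ Z (g (A' ∷ʳ ρ))) (ih A' ≤-refl bA') (G.∷ʳ-ImmSucc-image bA)
          imme : ImmSucc S₂ (embed A') (embed (A' ∷ʳ ρ))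
          imme = E.∷ʳ-ImmSucc-image bA
          sameEntries : ∀ j → j < length A' →
            nth false (nth [] (g (A' ∷ʳ ρ)) (length (embed A'))) (V.lengthAt j) ≡
            nth false (nth [] (embed (A' ∷ʳ ρ)) (length (embed A'))) (V.lengthAt j)
          sameEntries j j<|A'| = begin
              nth false (nth [] (g (A' ∷ʳ ρ)) (length (embed A'))) (V.lengthAt j)
            ≡⟨ cong₂ (λ r i → nth false (nth [] (g (A' ∷ʳ ρ)) r) i)
                     (cong length (sym (ih A' ≤-refl bA'))) (trans ℓj≡ (cong length (sym (ih Aj |Aj|≤|A'| bAj)))) ⟩
              nth false (nth [] (g (A' ∷ʳ ρ)) (length (g A'))) (length (g Aj))
            ≡⟨ G.row-entry bA j<|A'| ⟩
              nth false ρ j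
            ≡⟨ sym (E.row-entry bA j<|A'|) ⟩
              nth false (nth [] (embed (A' ∷ʳ ρ)) (length (embed A'))) (length (embed Aj))
            ≡⟨ cong (nth false (nth [] (embed (A' ∷ʳ ρ)) (length (embed A')))) (sym ℓj≡) ⟩
              nth false (nth [] (embed (A' ∷ʳ ρ)) (length (embed A'))) (V.lengthAt j)
            ∎
            where
              Aj : Mat
              Aj = take j A'
              |Aj|≡j : length Aj ≡ j
              |Aj|≡j = length-take-≤ j A' (<⇒≤ j<|A'|)
              |Aj|≤|A'| : length Aj ≤ length A'
              |Aj|≤|A'| = ⊑⇒length≤ (take-⊑ j A')
              bAj : Below k Aj
              bAj = Below-⊑ k bA' (take-⊑ j A')
              ℓj≡ : V.lengthAt j ≡ length (embed Aj)
              ℓj≡ = trans (lengthAt-≡ j (<k⇒<k' (subst (_<∞ k) |Aj|≡j (proj₂ bAj))))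
                          (sym (trans (length-embed bAj) (cong M.lengthAt |Aj|≡j)))

  hasUniqueStructIso : HasUniqueStructIso k T
  hasUniqueStructIso = (embed , embed-IsStructIso) ,
    λ f g f-iso g-iso A bA → trans (structIso≡embed f f-iso A bA) (sym (structIso≡embed g g-iso A bA))

¬Below-fin0 : ∀ {A} → ¬ Below (fin 0) A
¬Below-fin0 (_ , ())

empty⇒height0 : {X : Set} {S : List X → Set} {k : ℕ∞} → (∀ t → ¬ S t) → Height S k → k ≡ fin 0
empty⇒height0 {k = ω}           empty all       = ⊥-elim (empty _ (proj₁ (proj₂ (all 0))))
empty⇒height0 {k = fin zero}    _     _         = refl
empty⇒height0 {k = fin (suc h)} empty (_ , all) = ⊥-elim (empty _ (proj₁ (proj₂ (all 0 (s≤s z≤n)))))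

empty⇒HasUniqueStructIso : ∀ {k T} → (∀ C → ¬ T C) → Height T k → HasUniqueStructIso k T
empty⇒HasUniqueStructIso empty heightT with refl ← empty⇒height0 empty heightT =
  ((λ A → A) , (λ _ → nowhere) , (λ _ _ → nowhere) , (λ C TC → ⊥-elim (empty C TC))
             , (λ _ _ → nowhere) , (λ _ _ → nowhere) , (λ _ _ _ → nowhere)) ,
  λ _ _ _ _ _ → nowhere
  where
    nowhere : ∀ {B : Set} {A} → Below (fin 0) A → B
    nowhere b = ⊥-elim (¬Below-fin0 b)

lemma3p5 : (k : ℕ∞) (T : Mat → Set) → IsValuationTree T → Height T k →
           Σ (Mat → Mat) (IsStructIso k T) ×
           (∀ f g → IsStructIso k T f → IsStructIso k T g →
              ∀ A → Below k A → f A ≡ g A)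
lemma3p5 k T (k' , S₁ , S₂ , (strong₁ , strong₂ , height₁ , height₂ , sameLevels) , T⇔Val) heightT
  with strong₁ | strong₂
... | _ | inj₁ S₂-empty =
  empty⇒HasUniqueStructIso (λ C TC → S₂-empty C (Val⇒S₂ (proj₁ (T⇔Val C) TC))) heightT
... | inj₁ S₁-empty | inj₂ (_ , (r , r-IsRoot) , _) with refl ← empty⇒height0 S₁-empty height₁ =
  ⊥-elim (proj₁ height₂ r (proj₁ r-IsRoot , root-level r-IsRoot))
... | inj₂ (subtree₁ , rooted₁ , balanced₁ , levelsFlat₁ , branching₁)
    | inj₂ (subtree₂ , rooted₂ , balanced₂ , levelsFlat₂ , branching₂) =
  Valuation.hasUniqueStructIso k T k' S₁ S₂ subtree₁ rooted₁ balanced₁ levelsFlat₁ branching₁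
    subtree₂ rooted₂ balanced₂ levelsFlat₂ branching₂ height₁ height₂ sameLevels T⇔Val heightT
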